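{- Let $(\mathcal{L},\models,\mathfrak{M})$ be a satisfaction system with finite $\mathcal{L}$, let $\Phi_1,\ldots,\Phi_n\subseteq\mathcal{L}$ be non-trivial sets of statements, and let $\Phi,\Phi'\subseteq\mathcal{L}$ both be middle grounds for $\Phi_1,\ldots,\Phi_n$. Then either $\Phi\equiv\Phi'$ or $\Phi\cup\Phi'$ is inconsistent.
   Context: A satisfaction system is a triple $(\mathcal{L},\models,\mathfrak{M})$ where $\mathcal{L}$ is a language (a set of statements), $\mathfrak{M}$ a set of models and $\models\subseteq\mathfrak{M}\times\mathcal{L}$ a satisfaction relation. For $\Phi\subseteq\mathcal{L}$, $\pi\models\Phi$ iff $\pi\models\phi$ for all $\phi\in\Phi$; $\mathsf{mod}(\Phi)$ is the set of models $\pi\in\mathfrak{M}$ with $\pi\models\Phi$; $\Phi\models\Phi'$ iff every $\pi\in\mathfrak{M}$ with $\pi\models\Phi$ satisfies $\pi\models\Phi'$; $\Phi\equiv\Phi'$ iff $\Phi\models\Phi'$ and $\Phi'\models\Phi$. A statement $\phi$ is identified with $\{\phi\}$. $\Phi$ is consistent if $\mathsf{mod}(\Phi)\neq\emptyset$, falsifiable if $\mathsf{mod}(\Phi)\neq\mathfrak{M}$, and non-trivial if it is consistent and falsifiable. Given non-trivial sets $\Phi_1,\ldots,\Phi_n\subseteq\mathcal{L}$, a set $\Phi\subseteq\mathcal{L}$ is a middle ground for $\Phi_1,\ldots,\Phi_n$ if: (P1) $\Phi$ is non-trivial; (P2) if $\bigcup_{i=1}^n\Phi_i$ is consistent then $\Phi\equiv\bigcup_{i=1}^n\Phi_i$;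 (P3) for each $\phi\in\Phi$, all $i\in\{1,\ldots,n\}$ and all $\phi_i\in\Phi_i$ there is $\pi\in\mathfrak{M}$ with $\pi\models\phi$ and $\pi\models\phi_i$; (P4) for each $\phi\in\Phi$ there is $i$ with $\Phi_i\models\phi$; (P5) there is no $\Phi''\subseteq\mathcal{L}$ with $\Phi''\models\Phi$, $\Phi\not\models\Phi''$ and $\Phi''$ satisfying (P1)–(P4). -}

module Defs where

open import Level using (0ℓ) renaming (suc to lsuc)
open import Data.Nat using (ℕ)
open import Data.Fin using (Fin)
open import Data.Product using (Σ; ∃; _×_; _,_)
open import Data.Sum using (_⊎_)
open import Relation.Nullary using (¬_)
open import Relation.Unary using (Pred; _∈_; _∪_)
open import Function.Bundles using (_↔_)

record FiniteSatSystem : Set₁ where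
  field
    L      : Set
    M      : Set
    _⊨_    : M → L → Set
    finite : Σ ℕ (λ k → L ↔ Fin k)

module _ (S : FiniteSatSystem) where
  open FiniteSatSystem S

  Stmts : Set₁
  Stmts = Pred L 0ℓ

  _⊨ˢ_ : M → Stmts → Set
  π ⊨ˢ Φ = ∀ φ → φ ∈ Φ → π ⊨ φ

  mod : Stmts → Pred M 0ℓ
  mod Φ π = π ⊨ˢ Φ

  _⊧_ : Stmts → Stmts → Set
  Φ ⊧ Φ' = ∀ π → π ∈ mod Φ → π ∈ mod Φ'

  _≣_ : Stmts → Stmts → Set
  Φ ≣ Φ' = (Φ ⊧ Φ') × (Φ' ⊧ Φ)

  ⟦_⟧ : L → Stmts
  ⟦ φ ⟧ ψ = ψ Relation.Binary.PropositionalEquality.≡ φ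
    where import Relation.Binary.PropositionalEquality

  Consistent : Stmts → Set
  Consistent Φ = ∃ λ π → π ∈ mod Φ

  Falsifiable : Stmts → Set
  Falsifiable Φ = ¬ (∀ π → π ∈ mod Φ)

  NonTrivial : Stmts → Set
  NonTrivial Φ = Consistent Φ × Falsifiable Φ

  ⋃ : ∀ {n} → (Fin n → Stmts) → Stmts
  ⋃ Φs φ = ∃ λ i → φ ∈ Φs i

  P1 : Stmts → Set
  P1 Φ = NonTrivial Φ

  P2 : ∀ {n} → (Fin n → Stmts) → Stmts → Set
  P2 Φs Φ = Consistent (⋃ Φs) → Φ ≣ ⋃ Φs

  P3 : ∀ {n} → (Fin n → Stmts) → Stmts → Set
  P3 Φs Φ = ∀ φ → φ ∈ Φ → ∀ i → ∀ φᵢ → φᵢ ∈ Φs i →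
            ∃ λ π → (π ⊨ φ) × (π ⊨ φᵢ)

  P4 : ∀ {n} → (Fin n → Stmts) → Stmts → Set
  P4 Φs Φ = ∀ φ → φ ∈ Φ → ∃ λ i → Φs i ⊧ ⟦ φ ⟧

  P1-4 : ∀ {n} → (Fin n → Stmts) → Stmts → Set
  P1-4 Φs Φ = P1 Φ × P2 Φs Φ × P3 Φs Φ × P4 Φs Φ

  P5 : ∀ {n} → (Fin n → Stmts) → Stmts → Set₁
  P5 Φs Φ = ¬ (Σ Stmts λ Φ'' → (Φ'' ⊧ Φ) × ¬ (Φ ⊧ Φ'') × P1-4 Φs Φ'')

  MiddleGround : ∀ {n} → (Fin n → Stmts) → Stmts → Set₁
  MiddleGround Φs Φ = P1-4 Φs Φ × P5 Φs Φ

module Submission where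

open import Defs
open import Level using (0ℓ)
open import Data.Nat using (ℕ)
open import Data.Fin using (Fin)
open import Data.Sum using (_⊎_; inj₁; inj₂; [_,_]; swap)
open import Data.Product using (_,_; proj₁; proj₂)
open import Relation.Nullary using (¬_; yes; no)
open import Relation.Unary using (_∪_; _⊆_)
open import Axiom.ExcludedMiddle using (ExcludedMiddle)
open import Axiom.DoubleNegationElimination using (em⇒dne)

-- If Φ ∪ Φ' is consistent, it again satisfies (P1)–(P4) and entails both
-- Φ and Φ'. Maximality (P5) of Φ then rules out that Φ ∪ Φ' is strictly
-- stronger, i.e. Φ ⊧ Φ ∪ Φ' ⊧ Φ', and symmetrically Φ' ⊧ Φ.

module _ (S : FiniteSatSystem) where

  ⊆⇒⊧ : {Φ Ψ : Stmts S} → Ψ ⊆ Φ → _⊧_ S Φ Ψ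
  ⊆⇒⊧ Ψ⊆Φ π π⊨Φ φ φ∈Ψ = π⊨Φ φ (Ψ⊆Φ φ∈Ψ)

  ⊧-trans : {Φ Ψ Θ : Stmts S} → _⊧_ S Φ Ψ → _⊧_ S Ψ Θ → _⊧_ S Φ Θ
  ⊧-trans Φ⊧Ψ Ψ⊧Θ π π⊨Φ = Ψ⊧Θ π (Φ⊧Ψ π π⊨Φ)

  ⊧-∪ : {Θ Φ Ψ : Stmts S} → _⊧_ S Θ Φ → _⊧_ S Θ Ψ → _⊧_ S Θ (Φ ∪ Ψ)
  ⊧-∪ Θ⊧Φ Θ⊧Ψ π π⊨Θ φ = [ Θ⊧Φ π π⊨Θ φ , Θ⊧Ψ π π⊨Θ φ ]

  consistent-⊧ : {Φ Ψ : Stmts S} → _⊧_ S Φ Ψ → Consistent S Φ → Consistent S Ψ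
  consistent-⊧ Φ⊧Ψ (π , π⊨Φ) = π , Φ⊧Ψ π π⊨Φ

  falsifiable-⊧ : {Φ Ψ : Stmts S} → _⊧_ S Φ Ψ → Falsifiable S Ψ → Falsifiable S Φ
  falsifiable-⊧ Φ⊧Ψ Ψ-falsifiable all⊨Φ = Ψ-falsifiable (λ π → Φ⊧Ψ π (all⊨Φ π))

  module _ {n : ℕ} (Φs : Fin n → Stmts S) where

    P1-4-∪ : {Φ Ψ : Stmts S} → P1-4 S Φs Φ → P1-4 S Φs Ψ →
             Consistent S (Φ ∪ Ψ) → P1-4 S Φs (Φ ∪ Ψ)
    P1-4-∪ {Φ} {Ψ} ((_ , Φ-falsifiable) , p2Φ , p3Φ , p4Φ) (_ , p2Ψ , p3Ψ , p4Ψ) con =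
      (con , falsifiable-⊧ (⊆⇒⊧ inj₁) Φ-falsifiable) , p2 , p3 , p4
      where
        p2 : P2 S Φs (Φ ∪ Ψ)
        p2 ⋃-con = ⊧-trans (⊆⇒⊧ inj₁) (proj₁ (p2Φ ⋃-con))
                 , ⊧-∪ (proj₂ (p2Φ ⋃-con)) (proj₂ (p2Ψ ⋃-con))
        p3 : P3 S Φs (Φ ∪ Ψ)
        p3 φ = [ p3Φ φ , p3Ψ φ ]
        p4 : P4 S Φs (Φ ∪ Ψ)
        p4 φ = [ p4Φ φ , p4Ψ φ ]

    P5⇒⊧ : ExcludedMiddle 0ℓ → {Φ Ψ : Stmts S} → P5 S Φs Φ →
           P1-4 S Φs Ψ → _⊧_ S Ψ Φ → _⊧_ S Φ Ψ
    P5⇒⊧ em {Ψ = Ψ} p5 p1-4 Ψ⊧Φ = em⇒dne em (λ Φ⊭Ψ → p5 (Ψ , Ψ⊧Φ , Φ⊭Ψ , p1-4))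

    middleGround-⊧ : ExcludedMiddle 0ℓ → {Φ Ψ : Stmts S} →
                     MiddleGround S Φs Φ → MiddleGround S Φs Ψ →
                     Consistent S (Φ ∪ Ψ) → _⊧_ S Φ Ψ
    middleGround-⊧ em (p1-4Φ , p5Φ) (p1-4Ψ , _) con =
      ⊧-trans (P5⇒⊧ em p5Φ (P1-4-∪ p1-4Φ p1-4Ψ con) (⊆⇒⊧ inj₁)) (⊆⇒⊧ inj₂)

proposition4 : ExcludedMiddle 0ℓ →
    (S : FiniteSatSystem) (n : ℕ) (Φs : Fin n → Stmts S) →
    (∀ i → NonTrivial S (Φs i)) →
    (Φ Φ' : Stmts S) →
    MiddleGround S Φs Φ → MiddleGround S Φs Φ' →
    (_≣_ S Φ Φ') ⊎ ¬ Consistent S (Φ ∪ Φ')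
proposition4 em S n Φs _ Φ Φ' mg mg' with em {Consistent S (Φ ∪ Φ')}
... | no ¬con = inj₂ ¬con
... | yes con = inj₁ ( middleGround-⊧ S Φs em mg mg' con
                     , middleGround-⊧ S Φs em mg' mg (consistent-⊧ S (⊆⇒⊧ S swap) con) )
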